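{- Let $q$ be a prime power and let $(\star)$ be a linear system $\sum_{j=1}^k a_{ij}x_j=0$ ($i\in[m]$) over $\mathbb{F}_q$ in unknowns in $\mathbb{F}_q^n$. Suppose $(\star)$ is equivalent to a linear system whose coefficient matrix is $\begin{pmatrix}A_1&0\\0&A_2\end{pmatrix}$ for some $A_1\in\mathbb{F}_q^{m_1\times k_1}$ and $A_2\in\mathbb{F}_q^{m_2\times k_2}$ with $m_1,m_2,k_1,k_2\neq 0$. Then $(\star)$ is moderate if and only if the linear systems with coefficient matrices $A_1$ and $A_2$ are both moderate.
   Context: Two linear systems are equivalent if each equation of either is a linear combination of the equations of the other. A linear system in $k$ unknowns is moderate if there exist constants $\beta,\gamma>0$ with $\gamma<q$ such that for every $n$, every $S\subseteq\mathbb{F}_q^n$ with $|S|\ge\beta\gamma^n$ contains a solution $(x_1,\dots,x_k)\in S^k$ of the system with $x_1,\dots,x_k$ pairwise distinct.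
   Formalization: The constants β and γ in the definition of a moderate system are taken in the rationals. -}

module Defs where

open import Level using (0ℓ)
open import Data.Nat using (ℕ; zero; suc; _+_)
open import Data.Integer using (+_)
open import Data.Rational using (ℚ; _/_; _*_; _≤_; _<_; 1ℚ; 0ℚ)
open import Data.Fin using (Fin; zero; suc; splitAt)
open import Data.Sum using (inj₁; inj₂)
open import Data.Product using (Σ; ∃; _×_; _,_)
open import Data.Vec using (Vec; lookup)
open import Data.List using (List; length)
open import Data.List.Membership.Propositional using (_∈_)
open import Data.List.Relation.Unary.Unique.Propositional using (Unique)
open import Function.Bundles using (_↔_)
open import Relation.Binary.PropositionalEquality using (_≡_; _≢_)
open import Algebra.Core using (Op₁; Op₂)
open import Algebra.Structures using (IsCommutativeRing)

-- A finite field with exactly q elements (equality is propositional equality).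
-- Such a field exists iff q is a prime power, and it is unique up to isomorphism.
record FiniteField (q : ℕ) : Set₁ where
  field
    Carrier : Set
    _+F_ : Op₂ Carrier
    _*F_ : Op₂ Carrier
    -F_  : Op₁ Carrier
    0F 1F : Carrier
    isCommutativeRing : IsCommutativeRing _≡_ _+F_ _*F_ -F_ 0F 1F
    0≢1 : 0F ≢ 1F
    inverse : ∀ x → x ≢ 0F → Σ Carrier (λ y → (x *F y) ≡ 1F)
    enumeration : Fin q ↔ Carrier

module _ {q : ℕ} (F : FiniteField q) where
  open FiniteField F

  sumF : ∀ {k} → (Fin k → Carrier) → Carrier
  sumF {zero}  f = 0F
  sumF {suc k} f = f zero +F sumF (λ j → f (suc j))

  Matrix : ℕ → ℕ → Set
  Matrix m k = Fin m → Fin k → Carrier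

  IsSolution : ∀ {m k n} → Matrix m k → (Fin k → Vec Carrier n) → Set
  IsSolution {m} {k} {n} A x =
    ∀ (i : Fin m) (t : Fin n) → sumF (λ j → A i j *F lookup (x j) t) ≡ 0F

  InRowSpan : ∀ {m' k} → Matrix m' k → (Fin k → Carrier) → Set
  InRowSpan {m'} {k} B r =
    Σ (Fin m' → Carrier) λ c → ∀ (j : Fin k) → r j ≡ sumF (λ l → c l *F B l j)

  Equivalent : ∀ {m m' k} → Matrix m k → Matrix m' k → Set
  Equivalent A B = (∀ i → InRowSpan B (A i)) × (∀ l → InRowSpan A (B l))

  blockDiag : ∀ {m₁ k₁ m₂ k₂} → Matrix m₁ k₁ → Matrix m₂ k₂ → Matrix (m₁ + m₂) (k₁ + k₂)
  blockDiag {m₁} {k₁} A₁ A₂ i j with splitAt m₁ i | splitAt k₁ j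
  ... | inj₁ i₁ | inj₁ j₁ = A₁ i₁ j₁
  ... | inj₁ _  | inj₂ _  = 0F
  ... | inj₂ _  | inj₁ _  = 0F
  ... | inj₂ i₂ | inj₂ j₂ = A₂ i₂ j₂

_^ℚ_ : ℚ → ℕ → ℚ
γ ^ℚ zero  = 1ℚ
γ ^ℚ suc n = γ * (γ ^ℚ n)

ℕtoℚ : ℕ → ℚ
ℕtoℚ n = (+ n) / 1

-- S is a duplicate-free list of vectors, |S| its length.
Moderate : ∀ {q : ℕ} (F : FiniteField q) {m k : ℕ} → Matrix F m k → Set
Moderate {q} F {m} {k} A =
  ∃ λ (β : ℚ) → ∃ λ (γ : ℚ) → (0ℚ < β) × (0ℚ < γ) × (γ < ℕtoℚ q) ×
    (∀ (n : ℕ) (S : List (Vec (FiniteField.Carrier F) n)) → Unique S →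
       β * (γ ^ℚ n) ≤ ℕtoℚ (length S) →
       Σ (Fin k → Vec (FiniteField.Carrier F) n) λ x →
         (∀ j → x j ∈ S) × (∀ i j → x i ≡ x j → i ≡ j) × IsSolution F A x)

module Submission where

-- Solutions of a linear system depend only on its row space, so equivalent systems are
-- moderate together, and the solutions of diag(A₁, A₂) are exactly the concatenations of a
-- solution of A₁ with a solution of A₂.  Restricting solutions therefore shows that A₁ and A₂
-- are moderate with the constants of diag(A₁, A₂).  Conversely, with γ = max(γ₁, γ₂, 1) and
-- β = β₁ + β₂ + k₁, a duplicate-free S ⊆ F_qⁿ with |S| ≥ βγⁿ contains a solution x₁ of A₁
-- with distinct entries; removing those k₁ entries leaves at least β₂γ₂ⁿ elements (as
-- γⁿ ≥ 1), hence a solution x₂ of A₂ with distinct entries, all different from those of x₁.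

open import Defs
open import Level using (0ℓ)
open import Algebra.Bundles using (CommutativeRing)
open import Data.Empty using (⊥-elim)
open import Data.Fin as Fin using (Fin; zero; suc; _↑ˡ_; _↑ʳ_; splitAt; join)
open import Data.Fin.Properties using (join-splitAt; splitAt-↑ˡ; splitAt-↑ʳ; splitAt⁻¹-↑ˡ; splitAt⁻¹-↑ʳ; ↑ˡ-injective; ↑ʳ-injective)
open import Data.Integer as ℤ using (+≤+; +<+)
import Data.Integer.Properties as ℤₚ
open import Data.List using (List; []; _∷_; length; filter)
open import Data.List.Properties using (filter-all)
import Data.List.Relation.Unary.All as All
open import Data.List.Relation.Unary.AllPairs using ([]; _∷_)
open import Data.List.Membership.Propositional using (_∈_)
open import Data.List.Membership.Propositional.Properties using (∈-filter⁻)
open import Data.List.Relation.Unary.Unique.Propositional using (Unique)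
import Data.List.Relation.Unary.Unique.Propositional.Properties as Uniqueₚ
open import Data.Nat as ℕ using (ℕ; zero; suc; z≤n; s≤s)
import Data.Nat.Properties as ℕₚ
import Data.Nat.Coprimality as Coprime
open import Data.Product using (Σ; _×_; _,_; proj₁; proj₂; uncurry)
open import Data.Rational using (ℚ; mkℚ; _/_; nonNegative; 0ℚ; 1ℚ; _+_; _*_; -_; _⊔_; _≤_; _<_; *≤*; *<*)
import Data.Rational.Properties as ℚₚ
open import Data.Sum using (inj₁; inj₂; [_,_])
open import Data.Vec using (Vec; lookup)
open import Data.Vec.Functional using (_++_)
open import Data.Vec.Functional.Properties using (lookup-++ˡ; lookup-++ʳ)
open import Data.Vec.Properties using (≡-dec)
open import Function using (_∘_; id)
open import Function.Bundles using (_⇔_; mk⇔; Injection)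
open import Function.Construct.Composition using (_⇔-∘_)
open import Function.Construct.Symmetry using (↔-sym)
open import Function.Properties.Inverse using (↔⇒↣)
open import Relation.Binary.Definitions using (DecidableEquality)
open import Relation.Binary.PropositionalEquality hiding ([_])
open import Relation.Nullary using (Dec; yes; no)
open import Relation.Nullary.Decidable using (via-injection; ¬?)

↑-elim : ∀ {m n} {P : Fin (m ℕ.+ n) → Set} →
         (∀ i → P (i ↑ˡ n)) → (∀ j → P (m ↑ʳ j)) → ∀ i → P i
↑-elim {m} {n} {P} left right i =
  subst P (join-splitAt m n i) ([_,_] {C = P ∘ join m n} left right (splitAt m i))

distinct⇒2≤ : ∀ {n} {i j : Fin n} → i ≢ j → 2 ℕ.≤ n
distinct⇒2≤ {suc zero} {zero} {zero} i≢j = ⊥-elim (i≢j refl)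
distinct⇒2≤ {suc (suc n)} _ = s≤s (s≤s z≤n)

++-injective : ∀ {m n} {A : Set} (x : Fin m → A) (y : Fin n → A) →
               (∀ i j → x i ≡ x j → i ≡ j) → (∀ i j → y i ≡ y j → i ≡ j) →
               (∀ i j → x i ≢ y j) →
               ∀ i j → (x ++ y) i ≡ (x ++ y) j → i ≡ j
++-injective {m} {n} x y x-injective y-injective x≢y i j eq
  with splitAt m i in i≡ | splitAt m j in j≡
... | inj₁ a | inj₁ b =
  trans (sym (splitAt⁻¹-↑ˡ i≡)) (trans (cong (_↑ˡ n) (x-injective a b eq)) (splitAt⁻¹-↑ˡ j≡))
... | inj₁ a | inj₂ b = ⊥-elim (x≢y a b eq)
... | inj₂ a | inj₁ b = ⊥-elim (x≢y b a (sym eq))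
... | inj₂ a | inj₂ b =
  trans (sym (splitAt⁻¹-↑ʳ i≡)) (trans (cong (m ↑ʳ_) (y-injective a b eq)) (splitAt⁻¹-↑ʳ j≡))

ℕtoℚ≡mkℚ : ∀ n → ℕtoℚ n ≡ mkℚ (ℤ.+ n) 0 (Coprime.sym (Coprime.1-coprimeTo n))
ℕtoℚ≡mkℚ n = ℚₚ.normalize-coprime (Coprime.sym (Coprime.1-coprimeTo n))

ℕtoℚ-mono-≤ : ∀ {m n} → m ℕ.≤ n → ℕtoℚ m ≤ ℕtoℚ n
ℕtoℚ-mono-≤ {m} {n} m≤n rewrite ℕtoℚ≡mkℚ m | ℕtoℚ≡mkℚ n =
  *≤* (ℤₚ.*-monoʳ-≤-nonNeg (ℤ.+ 1) (+≤+ m≤n))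

ℕtoℚ-+ : ∀ m n → ℕtoℚ (m ℕ.+ n) ≡ ℕtoℚ m + ℕtoℚ n
ℕtoℚ-+ m n = sym (begin
  ℕtoℚ m + ℕtoℚ n                            ≡⟨ cong₂ _+_ (ℕtoℚ≡mkℚ m) (ℕtoℚ≡mkℚ n) ⟩
  (ℤ.+ m ℤ.* ℤ.+ 1 ℤ.+ ℤ.+ n ℤ.* ℤ.+ 1) / 1  ≡⟨ cong₂ (λ a b → (a ℤ.+ b) / 1) (ℤₚ.*-identityʳ (ℤ.+ m))
                                                                              (ℤₚ.*-identityʳ (ℤ.+ n)) ⟩
  ℕtoℚ (m ℕ.+ n)                             ∎)
  where open ≡-Reasoning

ℕtoℚ-nonNeg : ∀ n → 0ℚ ≤ ℕtoℚ n
ℕtoℚ-nonNeg n = ℕtoℚ-mono-≤ (z≤n {n})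

1<ℕtoℚ : ∀ {n} → 2 ℕ.≤ n → 1ℚ < ℕtoℚ n
1<ℕtoℚ 2≤n = ℚₚ.<-≤-trans (*<* (+<+ (s≤s (s≤s z≤n)))) (ℕtoℚ-mono-≤ 2≤n)

0≤1 : 0ℚ ≤ 1ℚ
0≤1 = ℚₚ.nonNegative⁻¹ 1ℚ

*-monoˡ-≤ : ∀ {r p q} → 0ℚ ≤ r → p ≤ q → r * p ≤ r * q
*-monoˡ-≤ {r} 0≤r = ℚₚ.*-monoˡ-≤-nonNeg r {{nonNegative 0≤r}}

*-monoʳ-≤ : ∀ {r p q} → 0ℚ ≤ r → p ≤ q → p * r ≤ q * r
*-monoʳ-≤ {r} 0≤r = ℚₚ.*-monoʳ-≤-nonNeg r {{nonNegative 0≤r}}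

p≤p+q : ∀ {p q} → 0ℚ ≤ q → p ≤ p + q
p≤p+q {p} {q} 0≤q = subst (_≤ p + q) (ℚₚ.+-identityʳ p) (ℚₚ.+-monoʳ-≤ p 0≤q)

p≤q+p : ∀ {p q} → 0ℚ ≤ q → p ≤ q + p
p≤q+p {p} {q} 0≤q = subst (p ≤_) (ℚₚ.+-comm p q) (p≤p+q 0≤q)

+-cancelʳ-≤ : ∀ {p q r} → p + r ≤ q + r → p ≤ q
+-cancelʳ-≤ {p} {q} {r} p+r≤q+r =
  subst₂ _≤_ (+-r p) (+-r q) (ℚₚ.+-monoˡ-≤ (- r) p+r≤q+r)
  where
  +-r : ∀ s → s + r + - r ≡ s
  +-r s = trans (ℚₚ.+-assoc s r (- r)) (trans (cong (s +_) (ℚₚ.+-inverseʳ r)) (ℚₚ.+-identityʳ s))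

⊔-lub-< : ∀ {p q r} → p < r → q < r → p ⊔ q < r
⊔-lub-< {p} {q} {r} p<r q<r with ℚₚ.⊔-sel p q
... | inj₁ p⊔q≡p = subst (_< r) (sym p⊔q≡p) p<r
... | inj₂ p⊔q≡q = subst (_< r) (sym p⊔q≡q) q<r

^ℚ-nonNeg : ∀ {a} n → 0ℚ ≤ a → 0ℚ ≤ a ^ℚ n
^ℚ-nonNeg zero _ = 0≤1
^ℚ-nonNeg {a} (suc n) 0≤a = subst (_≤ a * a ^ℚ n) (ℚₚ.*-zeroʳ a) (*-monoˡ-≤ 0≤a (^ℚ-nonNeg n 0≤a))

^ℚ-monoˡ-≤ : ∀ {a b} n → 0ℚ ≤ a → a ≤ b → a ^ℚ n ≤ b ^ℚ n
^ℚ-monoˡ-≤ zero _ _ = ℚₚ.≤-refl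
^ℚ-monoˡ-≤ {a} {b} (suc n) 0≤a a≤b = begin
  a * a ^ℚ n  ≤⟨ *-monoˡ-≤ 0≤a (^ℚ-monoˡ-≤ n 0≤a a≤b) ⟩
  a * b ^ℚ n  ≤⟨ *-monoʳ-≤ (^ℚ-nonNeg n (ℚₚ.≤-trans 0≤a a≤b)) a≤b ⟩
  b * b ^ℚ n  ∎
  where open ℚₚ.≤-Reasoning

1≤^ℚ : ∀ {a} n → 1ℚ ≤ a → 1ℚ ≤ a ^ℚ n
1≤^ℚ zero _ = ℚₚ.≤-refl
1≤^ℚ {a} (suc n) 1≤a = begin
  1ℚ          ≤⟨ 1≤a ⟩
  a           ≡⟨ ℚₚ.*-identityʳ a ⟨
  a * 1ℚ      ≤⟨ *-monoˡ-≤ (ℚₚ.≤-trans 0≤1 1≤a) (1≤^ℚ n 1≤a) ⟩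
  a * a ^ℚ n  ∎
  where open ℚₚ.≤-Reasoning

module _ {β₁ β₂ K : ℚ} (0≤β₁ : 0ℚ ≤ β₁) (0≤β₂ : 0ℚ ≤ β₂) (0≤K : 0ℚ ≤ K) where
  open ℚₚ.≤-Reasoning

  β₁γ₁ⁿ≤βγⁿ : ∀ {γ₁ γ} n → 0ℚ ≤ γ₁ → γ₁ ≤ γ → β₁ * γ₁ ^ℚ n ≤ (β₁ + β₂ + K) * γ ^ℚ n
  β₁γ₁ⁿ≤βγⁿ {γ₁} {γ} n 0≤γ₁ γ₁≤γ = begin
    β₁ * γ₁ ^ℚ n             ≤⟨ *-monoˡ-≤ 0≤β₁ (^ℚ-monoˡ-≤ n 0≤γ₁ γ₁≤γ) ⟩
    β₁ * γ ^ℚ n              ≤⟨ *-monoʳ-≤ (^ℚ-nonNeg n (ℚₚ.≤-trans 0≤γ₁ γ₁≤γ)) β₁≤β ⟩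
    (β₁ + β₂ + K) * γ ^ℚ n   ∎
    where
    β₁≤β : β₁ ≤ β₁ + β₂ + K
    β₁≤β = ℚₚ.≤-trans (p≤p+q 0≤β₂) (p≤p+q 0≤K)

  β₂γ₂ⁿ+K≤βγⁿ : ∀ {γ₂ γ} n → 0ℚ ≤ γ₂ → γ₂ ≤ γ → 1ℚ ≤ γ →
                β₂ * γ₂ ^ℚ n + K ≤ (β₁ + β₂ + K) * γ ^ℚ n
  β₂γ₂ⁿ+K≤βγⁿ {γ₂} {γ} n 0≤γ₂ γ₂≤γ 1≤γ = begin
    β₂ * γ₂ ^ℚ n + K               ≤⟨ ℚₚ.+-mono-≤ (*-monoˡ-≤ 0≤β₂ (^ℚ-monoˡ-≤ n 0≤γ₂ γ₂≤γ)) K≤Kγⁿ ⟩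
    β₂ * γ ^ℚ n + K * γ ^ℚ n       ≡⟨ ℚₚ.*-distribʳ-+ (γ ^ℚ n) β₂ K ⟨
    (β₂ + K) * γ ^ℚ n              ≤⟨ *-monoʳ-≤ (^ℚ-nonNeg n (ℚₚ.≤-trans 0≤γ₂ γ₂≤γ))
                                                (ℚₚ.+-monoˡ-≤ K (p≤q+p 0≤β₁)) ⟩
    (β₁ + β₂ + K) * γ ^ℚ n         ∎
    where
    K≤Kγⁿ : K ≤ K * γ ^ℚ n
    K≤Kγⁿ = subst (_≤ K * γ ^ℚ n) (ℚₚ.*-identityʳ K) (*-monoˡ-≤ 0≤K (1≤^ℚ n 1≤γ))

module Deletion {V : Set} (_≟_ : DecidableEquality V) where

  _≢?_ : ∀ (w v : V) → Dec (w ≢ v)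
  w ≢? v = ¬? (w ≟ v)

  length-filter-≢ : ∀ v {S} → Unique S → length S ℕ.≤ suc (length (filter (_≢? v) S))
  length-filter-≢ v {[]} [] = z≤n
  length-filter-≢ v {w ∷ S} (w∉S ∷ S!) with w ≟ v
  ... | yes refl = s≤s (ℕₚ.≤-reflexive (cong length (sym (filter-all (_≢? w) (All.map ≢-sym w∉S)))))
  ... | no _     = s≤s (length-filter-≢ v S!)

  infixl 5 _∖_

  _∖_ : ∀ {k} → List V → (Fin k → V) → List V
  _∖_ {zero}  S x = S
  _∖_ {suc k} S x = filter (_≢? x zero) S ∖ (x ∘ suc)

  ∖-⊆ : ∀ {k} S (x : Fin k → V) {w} → w ∈ S ∖ x → w ∈ S
  ∖-⊆ {zero}  S x w∈ = w∈
  ∖-⊆ {suc k} S x w∈ = proj₁ (∈-filter⁻ (_≢? x zero) {xs = S} (∖-⊆ _ (x ∘ suc) w∈))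

  ∖-∉ : ∀ {k} S (x : Fin k → V) {w} → w ∈ S ∖ x → ∀ j → w ≢ x j
  ∖-∉ {suc k} S x w∈ zero    = proj₂ (∈-filter⁻ (_≢? x zero) {xs = S} (∖-⊆ _ (x ∘ suc) w∈))
  ∖-∉ {suc k} S x w∈ (suc j) = ∖-∉ _ (x ∘ suc) w∈ j

  ∖-unique : ∀ {k S} (x : Fin k → V) → Unique S → Unique (S ∖ x)
  ∖-unique {zero}  x S! = S!
  ∖-unique {suc k} x S! = ∖-unique (x ∘ suc) (Uniqueₚ.filter⁺ (_≢? x zero) S!)

  length-∖ : ∀ {k S} (x : Fin k → V) → Unique S → length S ℕ.≤ length (S ∖ x) ℕ.+ k
  length-∖ {zero}  x S! = ℕₚ.≤-reflexive (sym (ℕₚ.+-identityʳ _))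
  length-∖ {suc k} {S} x S! = begin
    length S                                  ≤⟨ length-filter-≢ (x zero) S! ⟩
    suc (length S₁)                           ≤⟨ s≤s (length-∖ (x ∘ suc) (Uniqueₚ.filter⁺ (_≢? x zero) S!)) ⟩
    suc (length (S₁ ∖ (x ∘ suc)) ℕ.+ k)       ≡⟨ ℕₚ.+-suc _ k ⟨
    length (S₁ ∖ (x ∘ suc)) ℕ.+ suc k         ∎
    where
    S₁ = filter (_≢? x zero) S
    open ℕₚ.≤-Reasoning

module _ {q : ℕ} (F : FiniteField q) where
  open FiniteField F

  commutativeRing : CommutativeRing 0ℓ 0ℓ
  commutativeRing = record
    { Carrier = Carrier ; _≈_ = _≡_ ; _+_ = _+F_ ; _*_ = _*F_ ; -_ = -F_ ; 0# = 0F ; 1# = 1F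
    ; isCommutativeRing = isCommutativeRing }

  open CommutativeRing commutativeRing
    using (+-assoc; +-identityˡ; +-identityʳ; *-assoc; zeroˡ; zeroʳ; semiring)
  open import Algebra.Properties.Semiring.Sum semiring
    using (sum; sum-cong-≗; sum-replicate-zero; ∑-comm; *-distribˡ-sum; *-distribʳ-sum)

  sumF≗sum : ∀ {k} (f : Fin k → Carrier) → sumF F f ≡ sum f
  sumF≗sum {zero}  f = refl
  sumF≗sum {suc k} f = cong (f zero +F_) (sumF≗sum (f ∘ suc))

  sumF-cong : ∀ {k} {f g : Fin k → Carrier} → (∀ j → f j ≡ g j) → sumF F f ≡ sumF F g
  sumF-cong {f = f} {g} f≗g = trans (sumF≗sum f) (trans (sum-cong-≗ f≗g) (sym (sumF≗sum g)))

  sumF-zero : ∀ {k} {f : Fin k → Carrier} → (∀ j → f j ≡ 0F) → sumF F f ≡ 0F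
  sumF-zero {k} f≗0 = trans (sumF-cong f≗0) (trans (sumF≗sum {k} (λ _ → 0F)) (sum-replicate-zero k))

  sumF-↑ : ∀ m {n} (f : Fin (m ℕ.+ n) → Carrier) →
           sumF F f ≡ sumF F (f ∘ (_↑ˡ n)) +F sumF F (f ∘ (m ↑ʳ_))
  sumF-↑ zero    f = sym (+-identityˡ _)
  sumF-↑ (suc m) f = trans (cong (f zero +F_) (sumF-↑ m (f ∘ suc))) (sym (+-assoc _ _ _))

  -- IsSolution F A x unfolds to  ∀ i t → lincomb (A i) x t ≡ 0F.
  lincomb : ∀ {k n} → (Fin k → Carrier) → (Fin k → Vec Carrier n) → Fin n → Carrier
  lincomb r x t = sumF F (λ j → r j *F lookup (x j) t)

  lincomb-congʳ : ∀ {k n} (r : Fin k → Carrier) {x y : Fin k → Vec Carrier n} →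
                  (∀ j → x j ≡ y j) → ∀ t → lincomb r x t ≡ lincomb r y t
  lincomb-congʳ r x≗y t = sumF-cong (λ j → cong (λ v → r j *F lookup v t) (x≗y j))

  lincomb-rowSpan : ∀ {m k n} (c : Fin m → Carrier) (B : Matrix F m k) (x : Fin k → Vec Carrier n) t →
                    lincomb (λ j → sumF F (λ l → c l *F B l j)) x t ≡
                    sumF F (λ l → c l *F lincomb (B l) x t)
  lincomb-rowSpan {m} {k} c B x t = begin
    sumF F (λ j → sumF F (λ l → c l *F B l j) *F xₜ j)
      ≡⟨ sumF≗sum {k} _ ⟩
    sum (λ j → sumF F (λ l → c l *F B l j) *F xₜ j)
      ≡⟨ sum-cong-≗ (λ j → cong (_*F xₜ j) (sumF≗sum {m} _)) ⟩
    sum (λ j → sum (λ l → c l *F B l j) *F xₜ j)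
      ≡⟨ sum-cong-≗ (λ j → *-distribʳ-sum (xₜ j) (λ l → c l *F B l j)) ⟩
    sum (λ j → sum (λ l → (c l *F B l j) *F xₜ j))
      ≡⟨ ∑-comm {k} {m} _ ⟩
    sum (λ l → sum (λ j → (c l *F B l j) *F xₜ j))
      ≡⟨ sum-cong-≗ (λ l → sum-cong-≗ (λ j → *-assoc (c l) (B l j) (xₜ j))) ⟩
    sum (λ l → sum (λ j → c l *F (B l j *F xₜ j)))
      ≡⟨ sum-cong-≗ (λ l → *-distribˡ-sum (c l) (λ j → B l j *F xₜ j)) ⟨
    sum (λ l → c l *F sum (λ j → B l j *F xₜ j))
      ≡⟨ sum-cong-≗ (λ l → cong (c l *F_) (sumF≗sum {k} _)) ⟨
    sum (λ l → c l *F lincomb (B l) x t)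
      ≡⟨ sumF≗sum {m} _ ⟨
    sumF F (λ l → c l *F lincomb (B l) x t)
      ∎
    where
    open ≡-Reasoning
    xₜ : Fin k → Carrier
    xₜ j = lookup (x j) t

  rowSpan-solution : ∀ {m m' k n} {A : Matrix F m k} {B : Matrix F m' k} →
                     (∀ i → InRowSpan F B (A i)) →
                     (x : Fin k → Vec Carrier n) → IsSolution F B x → IsSolution F A x
  rowSpan-solution {A = A} {B} A⊆B x sol i t with A⊆B i
  ... | c , Aᵢ≡ = trans (sumF-cong (λ j → cong (_*F lookup (x j) t) (Aᵢ≡ j)))
                 (trans (lincomb-rowSpan c B x t)
                 (sumF-zero (λ l → trans (cong (c l *F_) (sol l t)) (zeroʳ (c l)))))

  module _ {m₁ m₂ k₁ k₂} (A₁ : Matrix F m₁ k₁) (A₂ : Matrix F m₂ k₂) where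
    private
      D = blockDiag F A₁ A₂

    blockDiag-↑ˡ-↑ˡ : ∀ i j → D (i ↑ˡ m₂) (j ↑ˡ k₂) ≡ A₁ i j
    blockDiag-↑ˡ-↑ˡ i j rewrite splitAt-↑ˡ m₁ i m₂ | splitAt-↑ˡ k₁ j k₂ = refl

    blockDiag-↑ˡ-↑ʳ : ∀ i j → D (i ↑ˡ m₂) (k₁ ↑ʳ j) ≡ 0F
    blockDiag-↑ˡ-↑ʳ i j rewrite splitAt-↑ˡ m₁ i m₂ | splitAt-↑ʳ k₁ k₂ j = refl

    blockDiag-↑ʳ-↑ˡ : ∀ i j → D (m₁ ↑ʳ i) (j ↑ˡ k₂) ≡ 0F
    blockDiag-↑ʳ-↑ˡ i j rewrite splitAt-↑ʳ m₁ m₂ i | splitAt-↑ˡ k₁ j k₂ = refl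

    blockDiag-↑ʳ-↑ʳ : ∀ i j → D (m₁ ↑ʳ i) (k₁ ↑ʳ j) ≡ A₂ i j
    blockDiag-↑ʳ-↑ʳ i j rewrite splitAt-↑ʳ m₁ m₂ i | splitAt-↑ʳ k₁ k₂ j = refl

    lincomb-blockDiag-↑ˡ : ∀ {n} i (x : Fin (k₁ ℕ.+ k₂) → Vec Carrier n) t →
                           lincomb (D (i ↑ˡ m₂)) x t ≡ lincomb (A₁ i) (x ∘ (_↑ˡ k₂)) t
    lincomb-blockDiag-↑ˡ i x t =
      trans (sumF-↑ k₁ _)
      (trans (cong₂ _+F_ (sumF-cong (λ j → cong (_*F _) (blockDiag-↑ˡ-↑ˡ i j)))
                         (sumF-zero (λ j → trans (cong (_*F _) (blockDiag-↑ˡ-↑ʳ i j)) (zeroˡ _))))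
      (+-identityʳ _))

    lincomb-blockDiag-↑ʳ : ∀ {n} i (x : Fin (k₁ ℕ.+ k₂) → Vec Carrier n) t →
                           lincomb (D (m₁ ↑ʳ i)) x t ≡ lincomb (A₂ i) (x ∘ (k₁ ↑ʳ_)) t
    lincomb-blockDiag-↑ʳ i x t =
      trans (sumF-↑ k₁ _)
      (trans (cong₂ _+F_ (sumF-zero (λ j → trans (cong (_*F _) (blockDiag-↑ʳ-↑ˡ i j)) (zeroˡ _)))
                         (sumF-cong (λ j → cong (_*F _) (blockDiag-↑ʳ-↑ʳ i j))))
      (+-identityˡ _))

    blockDiag-solution⁻ˡ : ∀ {n} (x : Fin (k₁ ℕ.+ k₂) → Vec Carrier n) →
                           IsSolution F D x → IsSolution F A₁ (x ∘ (_↑ˡ k₂))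
    blockDiag-solution⁻ˡ x sol i t = trans (sym (lincomb-blockDiag-↑ˡ i x t)) (sol (i ↑ˡ m₂) t)

    blockDiag-solution⁻ʳ : ∀ {n} (x : Fin (k₁ ℕ.+ k₂) → Vec Carrier n) →
                           IsSolution F D x → IsSolution F A₂ (x ∘ (k₁ ↑ʳ_))
    blockDiag-solution⁻ʳ x sol i t = trans (sym (lincomb-blockDiag-↑ʳ i x t)) (sol (m₁ ↑ʳ i) t)

    blockDiag-solution⁺ : ∀ {n} {x₁ : Fin k₁ → Vec Carrier n} {x₂ : Fin k₂ → Vec Carrier n} →
                          IsSolution F A₁ x₁ → IsSolution F A₂ x₂ → IsSolution F D (x₁ ++ x₂)
    blockDiag-solution⁺ {x₁ = x₁} {x₂} sol₁ sol₂ = ↑-elim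
      (λ i t → trans (lincomb-blockDiag-↑ˡ i (x₁ ++ x₂) t)
               (trans (lincomb-congʳ (A₁ i) (lookup-++ˡ x₁ x₂) t) (sol₁ i t)))
      (λ i t → trans (lincomb-blockDiag-↑ʳ i (x₁ ++ x₂) t)
               (trans (lincomb-congʳ (A₂ i) (lookup-++ʳ x₁ x₂) t) (sol₂ i t)))

  index : Injection (setoid Carrier) (setoid (Fin q))
  index = ↔⇒↣ (↔-sym enumeration)

  _≟F_ : DecidableEquality Carrier
  _≟F_ = via-injection index Fin._≟_

  1<q : 1ℚ < ℕtoℚ q
  1<q = 1<ℕtoℚ (distinct⇒2≤ (0≢1 ∘ Injection.injective index))

  module VecDeletion {n : ℕ} = Deletion (≡-dec {n = n} _≟F_)
  open VecDeletion

  DistinctSolutionIn : ∀ {m k n} → Matrix F m k → List (Vec Carrier n) → Set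
  DistinctSolutionIn {k = k} {n} A S =
    Σ (Fin k → Vec Carrier n) λ x →
      (∀ j → x j ∈ S) × (∀ i j → x i ≡ x j → i ≡ j) × IsSolution F A x

  ModerateWith : ∀ {m k} → ℚ → ℚ → Matrix F m k → Set
  ModerateWith β γ A =
    ∀ n (S : List (Vec Carrier n)) → Unique S → β * γ ^ℚ n ≤ ℕtoℚ (length S) → DistinctSolutionIn A S

  module _ {m m' k k'} {A : Matrix F m k} {A' : Matrix F m' k'} (e : Fin k' → Fin k)
           (e-injective : ∀ i j → e i ≡ e j → i ≡ j)
           (solution-pullback : ∀ {n} (x : Fin k → Vec Carrier n) →
                                IsSolution F A x → IsSolution F A' (x ∘ e))
           where

    distinctSolutionIn-reindex : ∀ {n} {S : List (Vec Carrier n)} →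
                                 DistinctSolutionIn A S → DistinctSolutionIn A' S
    distinctSolutionIn-reindex (x , x∈S , x-injective , sol) =
      x ∘ e , x∈S ∘ e , (λ i j → e-injective i j ∘ x-injective (e i) (e j)) , solution-pullback x sol

    moderate-reindex : Moderate F A → Moderate F A'
    moderate-reindex (β , γ , 0<β , 0<γ , γ<q , large⇒solution) =
      β , γ , 0<β , 0<γ , γ<q ,
      λ n S S! large → distinctSolutionIn-reindex (large⇒solution n S S! large)

  moderate-equivalent : ∀ {m m' k} {A : Matrix F m k} {B : Matrix F m' k} →
                        Equivalent F A B → Moderate F A ⇔ Moderate F B
  moderate-equivalent (A⊆B , B⊆A) =
    mk⇔ (moderate-reindex id (λ _ _ → id) (rowSpan-solution B⊆A))
        (moderate-reindex id (λ _ _ → id) (rowSpan-solution A⊆B))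

  module _ {m₁ m₂ k₁ k₂} {A₁ : Matrix F m₁ k₁} {A₂ : Matrix F m₂ k₂} where

    distinctSolutionIn-blockDiag : ∀ {n} {S : List (Vec Carrier n)} (s₁ : DistinctSolutionIn A₁ S) →
                                   DistinctSolutionIn A₂ (S ∖ proj₁ s₁) → DistinctSolutionIn (blockDiag F A₁ A₂) S
    distinctSolutionIn-blockDiag {S = S} (x₁ , x₁∈S , x₁-injective , sol₁)
                                         (x₂ , x₂∈S∖x₁ , x₂-injective , sol₂) =
      x₁ ++ x₂ , x∈S , ++-injective x₁ x₂ x₁-injective x₂-injective x₁≢x₂ ,
      blockDiag-solution⁺ A₁ A₂ sol₁ sol₂
      where
      x∈S : ∀ j → (x₁ ++ x₂) j ∈ S
      x∈S j with splitAt k₁ j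
      ... | inj₁ i = x₁∈S i
      ... | inj₂ i = ∖-⊆ S x₁ (x₂∈S∖x₁ i)
      x₁≢x₂ : ∀ i j → x₁ i ≢ x₂ j
      x₁≢x₂ i j x₁i≡x₂j = ∖-∉ S x₁ (x₂∈S∖x₁ j) i (sym x₁i≡x₂j)

    moderateWith-blockDiag : ∀ {β₁ β₂ γ₁ γ₂ γ} → 0ℚ ≤ β₁ → 0ℚ ≤ β₂ → 0ℚ ≤ γ₁ → 0ℚ ≤ γ₂ →
                             γ₁ ≤ γ → γ₂ ≤ γ → 1ℚ ≤ γ →
                             ModerateWith β₁ γ₁ A₁ → ModerateWith β₂ γ₂ A₂ →
                             ModerateWith (β₁ + β₂ + ℕtoℚ k₁) γ (blockDiag F A₁ A₂)
    moderateWith-blockDiag {β₁} {β₂} {γ₁} {γ₂} {γ} 0≤β₁ 0≤β₂ 0≤γ₁ 0≤γ₂ γ₁≤γ γ₂≤γ 1≤γ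
                           large⇒solution₁ large⇒solution₂ n S S! large =
      distinctSolutionIn-blockDiag s₁ (large⇒solution₂ n S' (∖-unique x₁ S!) large')
      where
      K = ℕtoℚ k₁
      s₁ = large⇒solution₁ n S S! (ℚₚ.≤-trans (β₁γ₁ⁿ≤βγⁿ 0≤β₁ 0≤β₂ (ℕtoℚ-nonNeg k₁) n 0≤γ₁ γ₁≤γ) large)
      x₁ = proj₁ s₁
      S' = S ∖ x₁
      open ℚₚ.≤-Reasoning
      large' : β₂ * γ₂ ^ℚ n ≤ ℕtoℚ (length S')
      large' = +-cancelʳ-≤ (begin
        β₂ * γ₂ ^ℚ n + K              ≤⟨ β₂γ₂ⁿ+K≤βγⁿ 0≤β₁ 0≤β₂ (ℕtoℚ-nonNeg k₁) n 0≤γ₂ γ₂≤γ 1≤γ ⟩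
        (β₁ + β₂ + K) * γ ^ℚ n        ≤⟨ large ⟩
        ℕtoℚ (length S)               ≤⟨ ℕtoℚ-mono-≤ (length-∖ x₁ S!) ⟩
        ℕtoℚ (length S' ℕ.+ k₁)       ≡⟨ ℕtoℚ-+ (length S') k₁ ⟩
        ℕtoℚ (length S') + K          ∎)

    moderate-blockDiag : Moderate F A₁ → Moderate F A₂ → Moderate F (blockDiag F A₁ A₂)
    moderate-blockDiag (β₁ , γ₁ , 0<β₁ , 0<γ₁ , γ₁<q , large⇒solution₁)
                       (β₂ , γ₂ , 0<β₂ , 0<γ₂ , γ₂<q , large⇒solution₂) =
      β₁ + β₂ + ℕtoℚ k₁ , γ , 0<β , 0<γ , γ<q ,
      moderateWith-blockDiag (ℚₚ.<⇒≤ 0<β₁) (ℚₚ.<⇒≤ 0<β₂) (ℚₚ.<⇒≤ 0<γ₁) (ℚₚ.<⇒≤ 0<γ₂)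
                             (ℚₚ.p≤q⇒p≤q⊔r 1ℚ (ℚₚ.p≤p⊔q γ₁ γ₂)) (ℚₚ.p≤q⇒p≤q⊔r 1ℚ (ℚₚ.p≤q⊔p γ₁ γ₂)) 1≤γ
                             large⇒solution₁ large⇒solution₂
      where
      γ = γ₁ ⊔ γ₂ ⊔ 1ℚ
      1≤γ : 1ℚ ≤ γ
      1≤γ = ℚₚ.p≤q⊔p (γ₁ ⊔ γ₂) 1ℚ
      0<γ : 0ℚ < γ
      0<γ = ℚₚ.<-≤-trans (ℚₚ.positive⁻¹ 1ℚ) 1≤γ
      γ<q : γ < ℕtoℚ q
      γ<q = ⊔-lub-< (⊔-lub-< γ₁<q γ₂<q) 1<q
      0<β : 0ℚ < β₁ + β₂ + ℕtoℚ k₁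
      0<β = ℚₚ.<-≤-trans 0<β₁ (ℚₚ.≤-trans (p≤p+q (ℚₚ.<⇒≤ 0<β₂)) (p≤p+q (ℕtoℚ-nonNeg k₁)))

    moderate-blockDiag⇔ : Moderate F (blockDiag F A₁ A₂) ⇔ (Moderate F A₁ × Moderate F A₂)
    moderate-blockDiag⇔ = mk⇔
      (λ mod → moderate-reindex (_↑ˡ k₂) (↑ˡ-injective k₂) (blockDiag-solution⁻ˡ A₁ A₂) mod
             , moderate-reindex (k₁ ↑ʳ_) (↑ʳ-injective k₁) (blockDiag-solution⁻ʳ A₁ A₂) mod)
      (uncurry moderate-blockDiag)

proposition2p2 : ∀ {q : ℕ} (F : FiniteField q) {m m₁ m₂ k₁ k₂ : ℕ}
    → m₁ ≢ 0 → m₂ ≢ 0 → k₁ ≢ 0 → k₂ ≢ 0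
    → (A : Matrix F m (k₁ ℕ.+ k₂)) (A₁ : Matrix F m₁ k₁) (A₂ : Matrix F m₂ k₂)
    → Equivalent F A (blockDiag F A₁ A₂)
    → Moderate F A ⇔ (Moderate F A₁ × Moderate F A₂)
proposition2p2 F _ _ _ _ _ _ _ A≈D = moderate-blockDiag⇔ F ⇔-∘ moderate-equivalent F A≈D
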